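{- Every path expression $E$ is equivalent to one of: $\mathit{id}$; $E'\cup\mathit{id}$; or $E'$, where $E'$ is an $\mathit{id}$-free path expression. (Two path expressions $E_1,E_2$ are equivalent if $[\![E_1]\!]^G=[\![E_2]\!]^G$ for every graph $G$.)
   Context: Fix two disjoint infinite sets $N$ (node names) and $P$ (property names). Path expressions: $E ::= \mathit{id} \mid p \mid p^- \mid E\cup E \mid E\circ E \mid E^*$ with $p\in P$; a path expression is $\mathit{id}$-free if $\mathit{id}$ does not occur in it. A graph $G$ is a finite set of triples $(a,p,b)$ with $a,b\in N$, $p\in P$. Semantics on $G$ (over the domain $N$): $[\![p]\!]^G=\{(a,b):(a,p,b)\in G\}$, $[\![\mathit{id}]\!]^G$ is the identity relation on $N$, $[\![p^-]\!]^G$ is the inverse of $[\![p]\!]^G$, $\cup$ is union, $\circ$ is relational composition, and $[\![E^*]\!]^G$ is the reflexive-transitive closure of $[\![E]\!]^G$ on $N$. -}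

module Defs where

open import Level using (0ℓ)
open import Data.Nat using (ℕ)
open import Data.Product using (_×_; _,_; Σ; ∃-syntax)
open import Data.Sum using (_⊎_)
open import Data.List using (List)
open import Data.List.Membership.Propositional using (_∈_)
open import Relation.Binary.PropositionalEquality using (_≡_)
open import Relation.Binary.Construct.Closure.ReflexiveTransitive using (Star)
open import Function.Bundles using (_↣_; _⇔_)

Infinite : Set → Set
Infinite A = ℕ ↣ A

module PathExpr (N P : Set) where

  data Expr : Set where
    idE   : Expr
    prop  : P → Expr
    inv   : P → Expr
    _∪E_  : Expr → Expr → Expr
    _∘E_  : Expr → Expr → Expr
    star  : Expr → Expr

  data IdFree : Expr → Set where
    prop  : ∀ p → IdFree (prop p)
    inv   : ∀ p → IdFree (inv p)
    _∪E_  : ∀ {E₁ E₂} → IdFree E₁ → IdFree E₂ → IdFree (E₁ ∪E E₂)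
    _∘E_  : ∀ {E₁ E₂} → IdFree E₁ → IdFree E₂ → IdFree (E₁ ∘E E₂)
    star  : ∀ {E} → IdFree E → IdFree (star E)

  -- A graph: a finite set of triples (a, p, b), given as a list.
  Graph : Set
  Graph = List (N × P × N)

  ⟦_⟧ : Expr → Graph → N → N → Set
  ⟦ idE ⟧     G a b = a ≡ b
  ⟦ prop p ⟧  G a b = (a , p , b) ∈ G
  ⟦ inv p ⟧   G a b = (b , p , a) ∈ G
  ⟦ E₁ ∪E E₂ ⟧ G a b = ⟦ E₁ ⟧ G a b ⊎ ⟦ E₂ ⟧ G a b
  ⟦ E₁ ∘E E₂ ⟧ G a b = ∃[ c ] (⟦ E₁ ⟧ G a c × ⟦ E₂ ⟧ G c b)
  ⟦ star E ⟧  G a b = Star (⟦ E ⟧ G) a b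

  _≈E_ : Expr → Expr → Set
  E₁ ≈E E₂ = ∀ (G : Graph) (a b : N) → ⟦ E₁ ⟧ G a b ⇔ ⟦ E₂ ⟧ G a b

-- Normalise bottom-up: every expression is equivalent to id, to an id-free F, or to
-- F ∪ id.  These three shapes are closed under ∪, and under ∘ because id is a unit
-- for ∘ and ∘ distributes over ∪; under star, (F ∪ id)* = F* as the star is reflexive.
module Submission where

open import Defs
open import Data.Product using (_×_; ∃-syntax; _,_; proj₁; proj₂)
open import Data.Sum using (_⊎_; inj₁; inj₂; [_,_])
open import Function using (id; _∘_)
open import Function.Bundles using (mk⇔)
open import Level using (Level)
open import Relation.Binary.Core using (Rel; _⇒_; _⇔_)
open import Relation.Binary.PropositionalEquality using (_≡_; refl; trans)
open import Relation.Binary.Construct.Union using (_∪_)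
open import Relation.Binary.Construct.Composition
open import Relation.Binary.Construct.Closure.ReflexiveTransitive
  using (Star; ε; fold; map; concat; return)

-- _;_ is the standard library's relational composition; its symbol is U+037E, not ASCII.
private
  variable
    a ℓ : Level
    A : Set a
    R R′ S S′ T : Rel A ℓ

⇔-refl : R ⇔ R
⇔-refl = id , id

⇔-sym : R ⇔ S → S ⇔ R
⇔-sym (f , g) = g , f

⇔-trans : R ⇔ S → S ⇔ T → R ⇔ T
⇔-trans (f , g) (h , k) = h ∘ f , g ∘ k

∪-cong : R ⇔ R′ → S ⇔ S′ → (R ∪ S) ⇔ (R′ ∪ S′)
∪-cong (f , g) (h , k) = [ inj₁ ∘ f , inj₂ ∘ h ] , [ inj₁ ∘ g , inj₂ ∘ k ]

;-cong : R ⇔ R′ → S ⇔ S′ → (R ; S) ⇔ (R′ ; S′)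
;-cong (f , g) (h , k) = (λ (c , x , y) → c , f x , h y) , (λ (c , x , y) → c , g x , k y)

Star-cong : R ⇔ S → Star R ⇔ Star S
Star-cong (f , g) = map f , map g

∪-comm : (R ∪ S) ⇔ (S ∪ R)
∪-comm = [ inj₂ , inj₁ ] , [ inj₂ , inj₁ ]

∪-assoc : ((R ∪ S) ∪ T) ⇔ (R ∪ (S ∪ T))
∪-assoc = [ [ inj₁ , inj₂ ∘ inj₁ ] , inj₂ ∘ inj₂ ]
        , [ inj₁ ∘ inj₁ , [ inj₁ ∘ inj₂ , inj₂ ] ]

∪-distribʳ-∪ : ((R ∪ S) ∪ T) ⇔ ((R ∪ T) ∪ (S ∪ T))
∪-distribʳ-∪ = [ [ inj₁ ∘ inj₁ , inj₂ ∘ inj₁ ] , inj₁ ∘ inj₂ ]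
             , [ [ inj₁ ∘ inj₁ , inj₂ ] , [ inj₁ ∘ inj₂ , inj₂ ] ]

∪-absorbˡ : R ⇒ S → (R ∪ S) ⇔ S
∪-absorbˡ R⇒S = [ R⇒S , id ] , inj₂

∪-absorbʳ : S ⇒ R → (R ∪ S) ⇔ R
∪-absorbʳ S⇒R = [ id , S⇒R ] , inj₁

;-identityˡ : (_≡_ ; R) ⇔ R
;-identityˡ = (λ { (_ , refl , y) → y }) , λ {x} y → x , refl , y

;-identityʳ : (R ; _≡_) ⇔ R
;-identityʳ = (λ { (_ , x , refl) → x }) , λ {_} {y} x → y , x , refl

;-distribˡ-∪ : (R ; (S ∪ T)) ⇔ ((R ; S) ∪ (R ; T))
;-distribˡ-∪ = (λ { (c , x , inj₁ y) → inj₁ (c , x , y)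
                   ; (c , x , inj₂ y) → inj₂ (c , x , y) })
             , [ (λ (c , x , y) → c , x , inj₁ y) , (λ (c , x , y) → c , x , inj₂ y) ]

;-distribʳ-∪ : ((R ∪ S) ; T) ⇔ ((R ; T) ∪ (S ; T))
;-distribʳ-∪ = (λ { (c , inj₁ x , y) → inj₁ (c , x , y)
                   ; (c , inj₂ x , y) → inj₂ (c , x , y) })
             , [ (λ (c , x , y) → c , inj₁ x , y) , (λ (c , x , y) → c , inj₂ x , y) ]

;-∪-identityˡ : ((R ∪ _≡_) ; S) ⇔ ((R ; S) ∪ S)
;-∪-identityˡ = ⇔-trans ;-distribʳ-∪ (∪-cong ⇔-refl ;-identityˡ)

;-∪-identityʳ : (R ; (S ∪ _≡_)) ⇔ ((R ; S) ∪ R)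
;-∪-identityʳ = ⇔-trans ;-distribˡ-∪ (∪-cong ⇔-refl ;-identityʳ)

Star-≡ : Star (_≡_ {A = A}) ⇔ _≡_
Star-≡ = fold _≡_ trans refl , λ { refl → ε }

Star-∪-≡ : Star (R ∪ _≡_) ⇔ Star R
Star-∪-≡ = concat ∘ map [ return , (λ { refl → ε }) ] , map inj₁

module _ {N P : Set} where
  open PathExpr N P

  data NormalForm : Set where
    identity   : NormalForm
    idFree     : (F : Expr) → IdFree F → NormalForm
    idFree∪id  : (F : Expr) → IdFree F → NormalForm

  ⌜_⌝ : NormalForm → Expr
  ⌜ identity ⌝      = idE
  ⌜ idFree F _ ⌝    = F
  ⌜ idFree∪id F _ ⌝ = F ∪E idE

  _∪ⁿ_ : NormalForm → NormalForm → NormalForm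
  identity        ∪ⁿ identity        = identity
  identity        ∪ⁿ idFree H h      = idFree∪id H h
  identity        ∪ⁿ idFree∪id H h   = idFree∪id H h
  idFree F f      ∪ⁿ identity        = idFree∪id F f
  idFree F f      ∪ⁿ idFree H h      = idFree (F ∪E H) (f ∪E h)
  idFree F f      ∪ⁿ idFree∪id H h   = idFree∪id (F ∪E H) (f ∪E h)
  idFree∪id F f   ∪ⁿ identity        = idFree∪id F f
  idFree∪id F f   ∪ⁿ idFree H h      = idFree∪id (F ∪E H) (f ∪E h)
  idFree∪id F f   ∪ⁿ idFree∪id H h   = idFree∪id (F ∪E H) (f ∪E h)

  _∘ⁿ_ : NormalForm → NormalForm → NormalForm
  identity        ∘ⁿ t               = t
  s               ∘ⁿ identity        = s
  idFree F f      ∘ⁿ idFree H h      = idFree (F ∘E H) (f ∘E h)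
  idFree F f      ∘ⁿ idFree∪id H h   = idFree ((F ∘E H) ∪E F) ((f ∘E h) ∪E f)
  idFree∪id F f   ∘ⁿ idFree H h      = idFree ((F ∘E H) ∪E H) ((f ∘E h) ∪E h)
  idFree∪id F f   ∘ⁿ idFree∪id H h   =
    idFree∪id (((F ∘E H) ∪E H) ∪E F) (((f ∘E h) ∪E h) ∪E f)

  starⁿ : NormalForm → NormalForm
  starⁿ identity        = identity
  starⁿ (idFree F f)    = idFree (star F) (star f)
  starⁿ (idFree∪id F f) = idFree (star F) (star f)

  normalise : Expr → NormalForm
  normalise idE        = identity
  normalise (prop p)   = idFree (prop p) (prop p)
  normalise (inv p)    = idFree (inv p) (inv p)
  normalise (E₁ ∪E E₂) = normalise E₁ ∪ⁿ normalise E₂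
  normalise (E₁ ∘E E₂) = normalise E₁ ∘ⁿ normalise E₂
  normalise (star E)   = starⁿ (normalise E)

  module _ (G : Graph) where

    ∪ⁿ-sound : ∀ s t → (⟦ ⌜ s ⌝ ⟧ G ∪ ⟦ ⌜ t ⌝ ⟧ G) ⇔ ⟦ ⌜ s ∪ⁿ t ⌝ ⟧ G
    ∪ⁿ-sound identity        identity        = ∪-absorbˡ id
    ∪ⁿ-sound identity        (idFree H h)    = ∪-comm
    ∪ⁿ-sound identity        (idFree∪id H h) = ∪-absorbˡ inj₂
    ∪ⁿ-sound (idFree F f)    identity        = ⇔-refl
    ∪ⁿ-sound (idFree F f)    (idFree H h)    = ⇔-refl
    ∪ⁿ-sound (idFree F f)    (idFree∪id H h) = ⇔-sym ∪-assoc
    ∪ⁿ-sound (idFree∪id F f) identity        = ∪-absorbʳ inj₂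
    ∪ⁿ-sound (idFree∪id F f) (idFree H h)    =
      ⇔-trans ∪-assoc (⇔-trans (∪-cong ⇔-refl ∪-comm) (⇔-sym ∪-assoc))
    ∪ⁿ-sound (idFree∪id F f) (idFree∪id H h) = ⇔-sym ∪-distribʳ-∪

    ∘ⁿ-sound : ∀ s t → (⟦ ⌜ s ⌝ ⟧ G ; ⟦ ⌜ t ⌝ ⟧ G) ⇔ ⟦ ⌜ s ∘ⁿ t ⌝ ⟧ G
    ∘ⁿ-sound identity        t               = ;-identityˡ
    ∘ⁿ-sound (idFree F f)    identity        = ;-identityʳ
    ∘ⁿ-sound (idFree∪id F f) identity        = ;-identityʳ
    ∘ⁿ-sound (idFree F f)    (idFree H h)    = ⇔-refl
    ∘ⁿ-sound (idFree F f)    (idFree∪id H h) = ;-∪-identityʳ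
    ∘ⁿ-sound (idFree∪id F f) (idFree H h)    = ;-∪-identityˡ
    ∘ⁿ-sound (idFree∪id F f) (idFree∪id H h) =
      ⇔-trans ;-∪-identityʳ (⇔-trans (∪-cong ;-∪-identityˡ ⇔-refl) (⇔-sym ∪-assoc))

    starⁿ-sound : ∀ s → Star (⟦ ⌜ s ⌝ ⟧ G) ⇔ ⟦ ⌜ starⁿ s ⌝ ⟧ G
    starⁿ-sound identity        = Star-≡
    starⁿ-sound (idFree F f)    = ⇔-refl
    starⁿ-sound (idFree∪id F f) = Star-∪-≡

    normalise-sound : ∀ E → ⟦ E ⟧ G ⇔ ⟦ ⌜ normalise E ⌝ ⟧ G
    normalise-sound idE        = ⇔-refl
    normalise-sound (prop p)   = ⇔-refl
    normalise-sound (inv p)    = ⇔-refl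
    normalise-sound (E₁ ∪E E₂) =
      ⇔-trans (∪-cong (normalise-sound E₁) (normalise-sound E₂))
              (∪ⁿ-sound (normalise E₁) (normalise E₂))
    normalise-sound (E₁ ∘E E₂) =
      ⇔-trans (;-cong (normalise-sound E₁) (normalise-sound E₂))
              (∘ⁿ-sound (normalise E₁) (normalise E₂))
    normalise-sound (star E)   =
      ⇔-trans (Star-cong (normalise-sound E)) (starⁿ-sound (normalise E))

  ≈E-normalise : ∀ E → E ≈E ⌜ normalise E ⌝
  ≈E-normalise E G _ _ = mk⇔ (proj₁ (normalise-sound G E)) (proj₂ (normalise-sound G E))

lemma3p3 : (N P : Set) → Infinite N → Infinite P →
    let open PathExpr N P in
    (E : Expr) →
    (E ≈E idE) ⊎ (∃[ E' ] (IdFree E' × (E ≈E (E' ∪E idE)))) ⊎ (∃[ E' ] (IdFree E' × (E ≈E E')))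
lemma3p3 N P _ _ E with normalise E | ≈E-normalise E
... | identity      | E≈ = inj₁ E≈
... | idFree∪id F f | E≈ = inj₂ (inj₁ (F , f , E≈))
... | idFree F f    | E≈ = inj₂ (inj₂ (F , f , E≈))
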